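{- For $n\ge1$ and $p\in\{\pm1,\dots,\pm n\}$, let $a(n,p)$ be the number of alternating signed permutations of size $n$ whose last letter is $\pi_n=p$. Then $a(1,1)=a(1,-1)=1$, and for $n\ge2$: if $n$ is even, $a(n,p)=\sum_{q\le p}a(n-1,q)$ for $p<0$ and $a(n,p)=\sum_{q<p}a(n-1,q)$ for $p>0$; if $n$ is odd, $a(n,p)=\sum_{q\ge p}a(n-1,q)$ for $p>0$ and $a(n,p)=\sum_{q>p}a(n-1,q)$ for $p<0$; where in each sum $q$ ranges over $\{\pm1,\dots,\pm(n-1)\}$.
   Context: A signed permutation of size $n$ is a word $\pi=\pi_1\cdots\pi_n$ over the nonzero integers such that $|\pi_1|,\dots,|\pi_n|$ is a permutation of $\{1,\dots,n\}$; letters are compared as integers. It is alternating if $\pi_1<\pi_2>\pi_3<\pi_4>\cdots$. -}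

module Defs where

open import Data.Nat as ℕ using (ℕ; zero; suc; _≤_)
open import Data.Integer as ℤ using (ℤ; +_; -_; ∣_∣; _<_; _>_)
open import Data.List using (List; []; _∷_; _++_; map; concatMap; length; filter; upTo)
open import Data.Nat.ListAction using (sum)
open import Data.List.Relation.Unary.All using (All; all?)
open import Data.List.Relation.Unary.Unique.Propositional using (Unique)
import Data.List.Relation.Unary.Unique.DecPropositional as UDec
open import Data.Product using (_×_)
open import Data.Unit using (⊤; tt)
open import Data.Empty using (⊥)
open import Relation.Binary.PropositionalEquality using (_≡_)
open import Relation.Nullary using (Dec; yes; no)
open import Relation.Nullary.Decidable using (_×-dec_)

letters : ℕ → List ℤ
letters n = map (λ k → + suc k) (upTo n) ++ map (λ k → - (+ suc k)) (upTo n)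

wordsOver : List ℤ → ℕ → List (List ℤ)
wordsOver A zero    = [] ∷ []
wordsOver A (suc n) = concatMap (λ x → map (x ∷_) (wordsOver A n)) A

-- A signed permutation of size n: a word of length n over the nonzero
-- integers whose absolute values |π₁|,…,|πₙ| form a permutation of {1,…,n},
-- i.e. they all lie in {1,…,n} and are pairwise distinct.
InRange : ℕ → ℤ → Set
InRange n x = (1 ≤ ∣ x ∣) × (∣ x ∣ ≤ n)

IsSignedPerm : ℕ → List ℤ → Set
IsSignedPerm n w = (length w ≡ n) × (All (InRange n) w × Unique (map ∣_∣ w))

AltUp AltDown : List ℤ → Set
AltUp []            = ⊤
AltUp (x ∷ [])      = ⊤
AltUp (x ∷ y ∷ r)   = (x < y) × AltDown (y ∷ r)
AltDown []          = ⊤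
AltDown (x ∷ [])    = ⊤
AltDown (x ∷ y ∷ r) = (x > y) × AltUp (y ∷ r)

Alternating : List ℤ → Set
Alternating = AltUp

LastIs : ℤ → List ℤ → Set
LastIs p []          = ⊥
LastIs p (x ∷ [])    = x ≡ p
LastIs p (x ∷ y ∷ r) = LastIs p (y ∷ r)

altUp? : (w : List ℤ) → Dec (AltUp w)
altDown? : (w : List ℤ) → Dec (AltDown w)
altUp? []          = yes tt
altUp? (x ∷ [])    = yes tt
altUp? (x ∷ y ∷ r) = (x ℤ.<? y) ×-dec altDown? (y ∷ r)
altDown? []          = yes tt
altDown? (x ∷ [])    = yes tt
altDown? (x ∷ y ∷ r) = (y ℤ.<? x) ×-dec altUp? (y ∷ r)

lastIs? : (p : ℤ) (w : List ℤ) → Dec (LastIs p w)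
lastIs? p []          = no (λ ())
lastIs? p (x ∷ [])    = x ℤ.≟ p
lastIs? p (x ∷ y ∷ r) = lastIs? p (y ∷ r)

isSignedPerm? : (n : ℕ) (w : List ℤ) → Dec (IsSignedPerm n w)
isSignedPerm? n w =
  (length w ℕ.≟ n) ×-dec
  (all? (λ x → (1 ℕ.≤? ∣ x ∣) ×-dec (∣ x ∣ ℕ.≤? n)) w ×-dec
   UDec.unique? ℕ._≟_ (map ∣_∣ w))

Counted : ℕ → ℤ → List ℤ → Set
Counted n p w = IsSignedPerm n w × (Alternating w × LastIs p w)

counted? : (n : ℕ) (p : ℤ) (w : List ℤ) → Dec (Counted n p w)
counted? n p w = isSignedPerm? n w ×-dec (altUp? w ×-dec lastIs? p w)

-- a(n,p): number of alternating signed permutations of size n with last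
-- letter p. Every signed permutation of size n is a word of length n over
-- letters n, and each such word occurs exactly once in  wordsOver (letters n) n,
-- so counting inside this list counts the set.
a : ℕ → ℤ → ℕ
a n p = length (filter (counted? n p) (wordsOver (letters n) n))

sumOver : ∀ {P : ℤ → Set} → ((q : ℤ) → Dec (P q)) → (ℤ → ℕ) → ℕ → ℕ
sumOver P? f m = sum (map f (filter P? (letters m)))

module Submission where

-- Deleting the last letter p of a signed permutation and pulling every letter of absolute
-- value above |p| one step towards 0 leaves a signed permutation of size n − 1; conversely
-- extend p re-inserts p, with bump |p| pushing letters back out. Both maps preserve the order
-- of letters, so alternation of the long word amounts to alternation of the short word plus
-- the last comparison, between bump |p| q and p, where q is the last letter of the short word:
-- bump |p| q < p for n even and bump |p| q > p for n odd. Hence a(n,p) is the sum of a(n−1,q)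
-- over the q satisfying that comparison, and unfolding bump gives the four ranges of q.

open import Defs
open import Data.Bool using (Bool; true; false; not)
open import Data.Empty using (⊥)
open import Data.Integer as ℤ
  using (ℤ; +_; -_; -[1+_]; ∣_∣; _<_; _≤?_; _<?_; -<-; -<+; +<+; -≤-; +≤+)
open import Data.Integer using () renaming (_<_ to _<ℤ_)
import Data.Integer.Properties as ℤ
open import Data.List
  using (List; []; _∷_; _++_; _∷ʳ_; map; concat; concatMap; filter; length; upTo; cartesianProductWith)
import Data.List.Properties as List
open import Data.List.Membership.Propositional using (_∈_; _∉_)
open import Data.List.Membership.Propositional.Properties
  using (∈-map⁺; ∈-map⁻; ∈-filter⁺; ∈-filter⁻; ∈-concat⁺′; ∈-concat⁻′; ∈-++⁺ˡ; ∈-++⁺ʳ; ∈-++⁻;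
         ∈-upTo⁺; ∈-upTo⁻; ∈-cartesianProductWith⁺)
open import Data.List.Membership.Propositional.Properties.WithK using (unique∧set⇒bag)
open import Data.List.Relation.Binary.BagAndSetEquality using (∼bag⇒↭)
open import Data.List.Relation.Binary.Permutation.Propositional.Properties using (↭-length)
open import Data.List.Relation.Unary.All as All using (All; []; _∷_)
import Data.List.Relation.Unary.All.Properties as All
open import Data.List.Relation.Unary.Any using (here; there)
import Data.List.Relation.Unary.AllPairs as AllPairs
open import Data.List.Relation.Unary.AllPairs using ([]; _∷_)
import Data.List.Relation.Unary.AllPairs.Properties as AllPairs
open import Data.List.Relation.Unary.Unique.Propositional using (Unique)
import Data.List.Relation.Unary.Unique.Propositional.Properties as Unique
open import Data.Nat as ℕ using (ℕ; zero; suc; _≤_; _∸_; _%_; s≤s; z≤n; s<s)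
import Data.Nat.Properties as ℕ
open import Data.Nat.ListAction using (sum)
open import Data.Product using (_×_; _,_; proj₁; proj₂; ∃)
open import Data.Sum using (inj₁; inj₂)
open import Data.Unit using (tt)
open import Function using (_∘_; _⇔_; mk⇔; Equivalence)
open import Relation.Nullary using (yes; no; contradiction)
open import Relation.Unary using (Decidable)
open import Relation.Binary.PropositionalEquality
open import Relation.Binary.Definitions using (tri<; tri≈; tri>)

private variable
  A B : Set

unique∧set⇒length≡ : {xs ys : List A} → Unique xs → Unique ys →
                     (∀ {z} → z ∈ xs ⇔ z ∈ ys) → length xs ≡ length ys
unique∧set⇒length≡ ux uy xs⇔ys = ↭-length (∼bag⇒↭ (unique∧set⇒bag ux uy xs⇔ys))

module _ {R : B → A → Set} (R? : ∀ q → Decidable (R q)) where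

  fibres : List B → List A → List A
  fibres qs xs = concat (map (λ q → filter (R? q) xs) qs)

  length-fibres : ∀ qs xs → length (fibres qs xs) ≡ sum (map (λ q → length (filter (R? q) xs)) qs)
  length-fibres []       xs = refl
  length-fibres (q ∷ qs) xs = trans (List.length-++ (filter (R? q) xs)) (cong (ℕ._+_ _) (length-fibres qs xs))

  ∈-fibres⁺ : ∀ {qs xs q v} → q ∈ qs → v ∈ xs → R q v → v ∈ fibres qs xs
  ∈-fibres⁺ q∈ v∈ r = ∈-concat⁺′ (∈-filter⁺ (R? _) v∈ r) (∈-map⁺ _ q∈)

  ∈-fibres⁻ : ∀ qs {xs v} → v ∈ fibres qs xs → ∃ λ q → q ∈ qs × R q v
  ∈-fibres⁻ qs {xs} v∈
    with _ , v∈ys , ys∈ ← ∈-concat⁻′ _ v∈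
    with q , q∈ , refl ← ∈-map⁻ (λ q → filter (R? q) xs) ys∈
    = q , q∈ , proj₂ (∈-filter⁻ (R? q) {xs = xs} v∈ys)

  fibres-unique : (∀ {q q′ v} → R q v → R q′ v → q ≡ q′) →
                  ∀ {qs xs} → Unique qs → Unique xs → Unique (fibres qs xs)
  fibres-unique functional {xs = xs} uqs uxs =
    Unique.concat⁺ (All.map⁺ (All.universal (λ q → Unique.filter⁺ (R? q) uxs) _))
                   (AllPairs.map⁺ (AllPairs.map (disjoint {xs = xs}) uqs))
    where
    disjoint : ∀ {q q′ xs} → q ≢ q′ → ∀ {v} → v ∈ filter (R? q) xs × v ∈ filter (R? q′) xs → ⊥
    disjoint {q} {q′} {xs} q≢q′ (v∈ , v∈′) =
      q≢q′ (functional (proj₂ (∈-filter⁻ (R? q) {xs = xs} v∈)) (proj₂ (∈-filter⁻ (R? q′) {xs = xs} v∈′)))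

unique-∷ʳ⁺ : ∀ {xs : List A} {x} → Unique xs → x ∉ xs → Unique (xs ∷ʳ x)
unique-∷ʳ⁺ uxs x∉xs = Unique.++⁺ uxs ([] ∷ []) λ { (x∈xs , here refl) → x∉xs x∈xs }

unique-∷ʳ⁻ : ∀ (xs : List A) {x} → Unique (xs ∷ʳ x) → Unique xs × x ∉ xs
unique-∷ʳ⁻ []       _          = [] , λ ()
unique-∷ʳ⁻ (y ∷ xs) (y∉ ∷ uxs) with uxs′ , x∉xs ← unique-∷ʳ⁻ xs uxs with y∉xs , y≢x ← All.∷ʳ⁻ y∉ =
  (y∉xs ∷ uxs′) , λ { (here refl) → y≢x refl ; (there x∈xs) → x∉xs x∈xs }

unique-map-∷ʳ⁻ : ∀ (f : A → B) u {x} → Unique (map f (u ∷ʳ x)) → All (λ y → f y ≢ f x) u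
unique-map-∷ʳ⁻ f u {x} unique = All.tabulate λ y∈u fy≡fx → fx∉ (subst (_∈ map f u) fy≡fx (∈-map⁺ f y∈u))
  where
  fx∉ : f x ∉ map f u
  fx∉ = proj₂ (unique-∷ʳ⁻ (map f u) (subst Unique (List.map-++ f u (x ∷ [])) unique))

map-preimage : ∀ (f : A → B) {ys} → All (λ y → ∃ λ x → f x ≡ y) ys → ∃ λ xs → map f xs ≡ ys
map-preimage f []              = [] , refl
map-preimage f ((x , refl) ∷ hs) with xs , refl ← map-preimage f hs = x ∷ xs , refl

wordsOver-suc : ∀ (A : List ℤ) n → wordsOver A (suc n) ≡ cartesianProductWith _∷_ A (wordsOver A n)
wordsOver-suc A n = go A
  where
  go : ∀ B → concatMap (λ x → map (x ∷_) (wordsOver A n)) B ≡ cartesianProductWith _∷_ B (wordsOver A n)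
  go []      = refl
  go (x ∷ B) = cong (map (x ∷_) (wordsOver A n) ++_) (go B)

wordsOver-unique : ∀ {A} n → Unique A → Unique (wordsOver A n)
wordsOver-unique zero    _  = [] ∷ []
wordsOver-unique {A} (suc n) uA = subst Unique (sym (wordsOver-suc A n))
  (Unique.cartesianProductWith⁺ _∷_ List.∷-injective uA (wordsOver-unique n uA))

∈-wordsOver : ∀ {A} w → All (_∈ A) w → w ∈ wordsOver A (length w)
∈-wordsOver         []      []          = here refl
∈-wordsOver {A} (x ∷ w) (x∈A ∷ w⊆A) = subst (x ∷ w ∈_) (sym (wordsOver-suc A (length w)))
  (∈-cartesianProductWith⁺ _∷_ x∈A (∈-wordsOver w w⊆A))

letters-unique : ∀ n → Unique (letters n)
letters-unique n = Unique.++⁺ (Unique.map⁺ +suc-injective (Unique.upTo⁺ n))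
                              (Unique.map⁺ -suc-injective (Unique.upTo⁺ n)) disjoint
  where
  +suc-injective : ∀ {k l} → + suc k ≡ + suc l → k ≡ l
  +suc-injective refl = refl
  -suc-injective : ∀ {k l} → - (+ suc k) ≡ - (+ suc l) → k ≡ l
  -suc-injective refl = refl
  disjoint : ∀ {x} → x ∈ map (λ k → + suc k) (upTo n) × x ∈ map (λ k → - (+ suc k)) (upTo n) → ⊥
  disjoint (x∈⁺ , x∈⁻)
    with _ , _ , refl ← ∈-map⁻ (λ k → + suc k) x∈⁺
    with _ , _ , ()   ← ∈-map⁻ (λ k → - (+ suc k)) x∈⁻

∈-letters⁺ : ∀ {n} x → InRange n x → x ∈ letters n
∈-letters⁺     (+ zero)   (() , _)
∈-letters⁺     (+ suc k)  (_ , k<n) = ∈-++⁺ˡ (∈-map⁺ (λ k → + suc k) (∈-upTo⁺ k<n))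
∈-letters⁺ {n} -[1+ k ]   (_ , k<n) =
  ∈-++⁺ʳ (map (λ k → + suc k) (upTo n)) (∈-map⁺ (λ k → - (+ suc k)) (∈-upTo⁺ k<n))

∈-letters⁻ : ∀ {n x} → x ∈ letters n → InRange n x
∈-letters⁻ {n} x∈ with ∈-++⁻ (map (λ k → + suc k) (upTo n)) x∈
... | inj₁ x∈⁺ with _ , k∈ , refl ← ∈-map⁻ (λ k → + suc k) x∈⁺       = s≤s z≤n , ∈-upTo⁻ k∈
... | inj₂ x∈⁻ with _ , k∈ , refl ← ∈-map⁻ (λ k → - (+ suc k)) x∈⁻ = s≤s z≤n , ∈-upTo⁻ k∈

bumpℕ : ℕ → ℕ → ℕ
bumpℕ j k with j ℕ.≤? k
... | yes _ = suc k
... | no  _ = k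

bump : ℕ → ℤ → ℤ
bump j (+ k) with j ℕ.≤? k
... | yes _ = + suc k
... | no  _ = + k
bump j -[1+ k ] with j ℕ.≤? suc k
... | yes _ = -[1+ suc k ]
... | no  _ = -[1+ k ]

∣bump∣ : ∀ j x → ∣ bump j x ∣ ≡ bumpℕ j ∣ x ∣
∣bump∣ j (+ k) with j ℕ.≤? k
... | yes _ = refl
... | no  _ = refl
∣bump∣ j -[1+ k ] with j ℕ.≤? suc k
... | yes _ = refl
... | no  _ = refl

bumpℕ-≢ : ∀ j k → bumpℕ j k ≢ j
bumpℕ-≢ j k with j ℕ.≤? k
... | yes j≤k = λ 1+k≡j → ℕ.<⇒≱ (s≤s j≤k) (ℕ.≤-reflexive 1+k≡j)
... | no  j≰k = λ k≡j → j≰k (ℕ.≤-reflexive (sym k≡j))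

bumpℕ-injective : ∀ j {k l} → bumpℕ j k ≡ bumpℕ j l → k ≡ l
bumpℕ-injective j {k} {l} eq with j ℕ.≤? k | j ℕ.≤? l
... | yes _   | yes _   = ℕ.suc-injective eq
... | yes j≤k | no  j≰l = contradiction (ℕ.≤-trans j≤k (ℕ.≤-trans (ℕ.n≤1+n k) (ℕ.≤-reflexive eq))) j≰l
... | no  j≰k | yes j≤l = contradiction (ℕ.≤-trans j≤l (ℕ.≤-trans (ℕ.n≤1+n l) (ℕ.≤-reflexive (sym eq)))) j≰k
... | no  _   | no  _   = eq

n≤bumpℕ : ∀ j k → k ≤ bumpℕ j k
n≤bumpℕ j k with j ℕ.≤? k
... | yes _ = ℕ.n≤1+n k
... | no  _ = ℕ.≤-refl

bumpℕ≤1+n : ∀ j k → bumpℕ j k ≤ suc k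
bumpℕ≤1+n j k with j ℕ.≤? k
... | yes _ = ℕ.≤-refl
... | no  _ = ℕ.n≤1+n k

bumpℕ-bounded⁻ : ∀ {j k m} → 1 ≤ j → j ≤ suc m →
                 1 ≤ bumpℕ j k → bumpℕ j k ≤ suc m → 1 ≤ k × k ≤ m
bumpℕ-bounded⁻ {j} {k} 1≤j j≤1+m 1≤b b≤1+m with j ℕ.≤? k
... | yes j≤k = ℕ.≤-trans 1≤j j≤k , ℕ.s≤s⁻¹ b≤1+m
... | no  j≰k = 1≤b , ℕ.s≤s⁻¹ (ℕ.≤-trans (ℕ.≰⇒> j≰k) j≤1+m)

bump-mono-< : ∀ j {x y} → x < y → bump j x < bump j y
bump-mono-< j {+ k} {+ l} (+<+ k<l) with j ℕ.≤? k | j ℕ.≤? l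
... | yes _   | yes _   = +<+ (s<s k<l)
... | yes j≤k | no  j≰l = contradiction (ℕ.≤-trans j≤k (ℕ.<⇒≤ k<l)) j≰l
... | no  _   | yes _   = +<+ (ℕ.m<n⇒m<1+n k<l)
... | no  _   | no  _   = +<+ k<l
bump-mono-< j { -[1+ k ]} {+ l} -<+ with j ℕ.≤? suc k | j ℕ.≤? l
... | yes _ | yes _ = -<+
... | yes _ | no  _ = -<+
... | no  _ | yes _ = -<+
... | no  _ | no  _ = -<+
bump-mono-< j { -[1+ k ]} { -[1+ l ]} (-<- l<k) with j ℕ.≤? suc k | j ℕ.≤? suc l
... | yes _   | yes _   = -<- (s<s l<k)
... | yes _   | no  _   = -<- (ℕ.m<n⇒m<1+n l<k)
... | no  j≰k | yes j≤l = contradiction (ℕ.≤-trans j≤l (ℕ.<⇒≤ (s<s l<k))) j≰k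
... | no  _   | no  _   = -<- l<k

bump-cancel-< : ∀ j {x y} → bump j x < bump j y → x < y
bump-cancel-< j {x} {y} bx<by with ℤ.<-cmp x y
... | tri< x<y _ _ = x<y
... | tri≈ _ refl _ = contradiction bx<by (ℤ.<-irrefl refl)
... | tri> _ _ y<x = contradiction (bump-mono-< j y<x) (ℤ.<-asym bx<by)

bump-injective : ∀ j {x y} → bump j x ≡ bump j y → x ≡ y
bump-injective j {x} {y} eq with ℤ.<-cmp x y
... | tri< x<y _ _ = contradiction (bump-mono-< j x<y) (ℤ.<-irrefl eq)
... | tri≈ _ x≡y _ = x≡y
... | tri> _ _ y<x = contradiction (bump-mono-< j y<x) (ℤ.<-irrefl (sym eq))

bump-surjective : ∀ {j} x → 1 ≤ j → ∣ x ∣ ≢ j → ∃ λ y → bump j y ≡ x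
bump-surjective {j} (+ k) _ k≢j with ℕ.<-cmp k j
... | tri≈ _ k≡j _ = contradiction k≡j k≢j
... | tri< k<j _ _ = + k , below
  where
  below : bump j (+ k) ≡ + k
  below with j ℕ.≤? k
  ... | yes j≤k = contradiction j≤k (ℕ.<⇒≱ k<j)
  ... | no  _   = refl
bump-surjective {j} (+ suc k) _ _ | tri> _ _ (s≤s j≤k) = + k , above
  where
  above : bump j (+ k) ≡ + suc k
  above with j ℕ.≤? k
  ... | yes _   = refl
  ... | no  j≰k = contradiction j≤k j≰k
bump-surjective {j} -[1+ k ] _ 1+k≢j with ℕ.<-cmp (suc k) j
... | tri≈ _ 1+k≡j _ = contradiction 1+k≡j 1+k≢j
... | tri< 1+k<j _ _ = -[1+ k ] , below
  where
  below : bump j -[1+ k ] ≡ -[1+ k ]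
  below with j ℕ.≤? suc k
  ... | yes j≤1+k = contradiction j≤1+k (ℕ.<⇒≱ 1+k<j)
  ... | no  _     = refl
bump-surjective {suc _} -[1+ zero ] (s≤s z≤n) _ | tri> _ _ (s≤s ())
bump-surjective {j} -[1+ suc k ] _ _ | tri> _ _ (s≤s j≤1+k) = -[1+ k ] , above
  where
  above : bump j -[1+ k ] ≡ -[1+ suc k ]
  above with j ℕ.≤? suc k
  ... | yes _     = refl
  ... | no  j≰1+k = contradiction j≤1+k j≰1+k

inRange-bump : ∀ {m} j {x} → InRange m x → InRange (suc m) (bump j x)
inRange-bump j {x} (1≤∣x∣ , ∣x∣≤m) rewrite ∣bump∣ j x =
  ℕ.≤-trans 1≤∣x∣ (n≤bumpℕ j ∣ x ∣) , ℕ.≤-trans (bumpℕ≤1+n j ∣ x ∣) (s≤s ∣x∣≤m)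

inRange-bump⁻ : ∀ {m j x} → 1 ≤ j → j ≤ suc m → InRange (suc m) (bump j x) → InRange m x
inRange-bump⁻ {j = j} {x} 1≤j j≤1+m (lower , upper) rewrite ∣bump∣ j x =
  bumpℕ-bounded⁻ 1≤j j≤1+m lower upper

map-∣bump∣ : ∀ j v → map ∣_∣ (map (bump j) v) ≡ map (bumpℕ j) (map ∣_∣ v)
map-∣bump∣ j v = begin
  map ∣_∣ (map (bump j) v)  ≡⟨ List.map-∘ v ⟨
  map (∣_∣ ∘ bump j) v      ≡⟨ List.map-cong (∣bump∣ j) v ⟩
  map (bumpℕ j ∘ ∣_∣) v     ≡⟨ List.map-∘ v ⟩
  map (bumpℕ j) (map ∣_∣ v) ∎
  where open ≡-Reasoning

Alt : Bool → List ℤ → Set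
Alt true  = AltUp
Alt false = AltDown

Step : Bool → ℤ → ℤ → Set
Step true  x y = x < y
Step false x y = y < x

-- The direction of the comparison k steps after one of direction b.
flips : ℕ → Bool → Bool
flips zero    b = b
flips (suc k) b = flips k (not b)

flips-even : ∀ k → k % 2 ≡ 0 → flips k true ≡ true
flips-even zero          _ = refl
flips-even (suc zero)    ()
flips-even (suc (suc k)) e = flips-even k e

flips-odd : ∀ k → k % 2 ≡ 1 → flips k true ≡ false
flips-odd zero          ()
flips-odd (suc zero)    _ = refl
flips-odd (suc (suc k)) e = flips-odd k e

module _ {f : ℤ → ℤ} where

  alt-map⁺ : (∀ {x y} → x < y → f x < f y) → ∀ b w → Alt b w → Alt b (map f w)
  alt-map⁺ mono true  []          _         = tt
  alt-map⁺ mono false []          _         = tt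
  alt-map⁺ mono true  (x ∷ [])    _         = tt
  alt-map⁺ mono false (x ∷ [])    _         = tt
  alt-map⁺ mono true  (x ∷ y ∷ w) (s , alt) = mono s , alt-map⁺ mono false (y ∷ w) alt
  alt-map⁺ mono false (x ∷ y ∷ w) (s , alt) = mono s , alt-map⁺ mono true  (y ∷ w) alt

  alt-map⁻ : (∀ {x y} → f x < f y → x < y) → ∀ b w → Alt b (map f w) → Alt b w
  alt-map⁻ cancel true  []          _         = tt
  alt-map⁻ cancel false []          _         = tt
  alt-map⁻ cancel true  (x ∷ [])    _         = tt
  alt-map⁻ cancel false (x ∷ [])    _         = tt
  alt-map⁻ cancel true  (x ∷ y ∷ w) (s , alt) = cancel s , alt-map⁻ cancel false (y ∷ w) alt
  alt-map⁻ cancel false (x ∷ y ∷ w) (s , alt) = cancel s , alt-map⁻ cancel true  (y ∷ w) alt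

alt-∷ʳ⁺ : ∀ b y r {z x} → Alt b (y ∷ r) → LastIs z (y ∷ r) → Step (flips (length r) b) z x →
          Alt b ((y ∷ r) ∷ʳ x)
alt-∷ʳ⁺ true  y []      _         refl s = s , tt
alt-∷ʳ⁺ false y []      _         refl s = s , tt
alt-∷ʳ⁺ true  y (t ∷ r) (s , alt) last st = s , alt-∷ʳ⁺ false t r alt last st
alt-∷ʳ⁺ false y (t ∷ r) (s , alt) last st = s , alt-∷ʳ⁺ true  t r alt last st

alt-∷ʳ⁻ : ∀ b y r {z x} → Alt b ((y ∷ r) ∷ʳ x) → LastIs z (y ∷ r) →
          Alt b (y ∷ r) × Step (flips (length r) b) z x
alt-∷ʳ⁻ true  y []      (s , _)   refl = tt , s
alt-∷ʳ⁻ false y []      (s , _)   refl = tt , s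
alt-∷ʳ⁻ true  y (t ∷ r) (s , alt) last with alt′ , st ← alt-∷ʳ⁻ false t r alt last = (s , alt′) , st
alt-∷ʳ⁻ false y (t ∷ r) (s , alt) last with alt′ , st ← alt-∷ʳ⁻ true  t r alt last = (s , alt′) , st

lastIs-exists : ∀ (y : ℤ) r → ∃ λ z → LastIs z (y ∷ r)
lastIs-exists y []      = y , refl
lastIs-exists y (t ∷ r) = lastIs-exists t r

lastIs-functional : ∀ {z z′} w → LastIs z w → LastIs z′ w → z ≡ z′
lastIs-functional (x ∷ [])    refl refl = refl
lastIs-functional (x ∷ y ∷ w) last last′ = lastIs-functional (y ∷ w) last last′

lastIs-map : ∀ (f : ℤ → ℤ) {z} w → LastIs z w → LastIs (f z) (map f w)
lastIs-map f (x ∷ [])    refl = refl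
lastIs-map f (x ∷ y ∷ w) last = lastIs-map f (y ∷ w) last

lastIs⇒∈ : ∀ {z} w → LastIs z w → z ∈ w
lastIs⇒∈ (x ∷ [])    refl = here refl
lastIs⇒∈ (x ∷ y ∷ w) last = there (lastIs⇒∈ (y ∷ w) last)

lastIs-∷ʳ : ∀ w (x : ℤ) → LastIs x (w ∷ʳ x)
lastIs-∷ʳ []          x = refl
lastIs-∷ʳ (y ∷ [])    x = refl
lastIs-∷ʳ (y ∷ t ∷ w) x = lastIs-∷ʳ (t ∷ w) x

lastIs⇒∷ʳ : ∀ {x} w → LastIs x w → ∃ λ u → w ≡ u ∷ʳ x
lastIs⇒∷ʳ (y ∷ [])    refl = [] , refl
lastIs⇒∷ʳ (y ∷ t ∷ w) last with u , eq ← lastIs⇒∷ʳ (t ∷ w) last = y ∷ u , cong (y ∷_) eq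

counted⇒∈wordsOver : ∀ {n p w} → Counted n p w → w ∈ wordsOver (letters n) n
counted⇒∈wordsOver {w = w} ((refl , inRange , _) , _) = ∈-wordsOver w (All.map (∈-letters⁺ _) inRange)

counted⇒last∈letters : ∀ {n q v} → Counted n q v → q ∈ letters n
counted⇒last∈letters {v = v} ((_ , inRange , _) , _ , last) =
  ∈-letters⁺ _ (All.lookup inRange (lastIs⇒∈ v last))

counted-functional : ∀ {n q q′ v} → Counted n q v → Counted n q′ v → q ≡ q′
counted-functional {v = v} (_ , _ , last) (_ , _ , last′) = lastIs-functional v last last′

extend : ℤ → List ℤ → List ℤ
extend p v = map (bump ∣ p ∣) v ∷ʳ p

length-extend : ∀ p v → length (extend p v) ≡ suc (length v)
length-extend p v = begin
  length (map (bump ∣ p ∣) v ∷ʳ p) ≡⟨ List.length-++ (map (bump ∣ p ∣) v) ⟩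
  length (map (bump ∣ p ∣) v) ℕ.+ 1 ≡⟨ ℕ.+-comm _ 1 ⟩
  suc (length (map (bump ∣ p ∣) v)) ≡⟨ cong suc (List.length-map (bump ∣ p ∣) v) ⟩
  suc (length v)                    ∎
  where open ≡-Reasoning

extend-injective : ∀ p {v v′} → extend p v ≡ extend p v′ → v ≡ v′
extend-injective p eq = List.map-injective (bump-injective ∣ p ∣) (proj₁ (List.∷ʳ-injective _ _ eq))

unique-extend⁺ : ∀ p {v} → Unique (map ∣_∣ v) → Unique (map ∣_∣ (extend p v))
unique-extend⁺ p {v} uv rewrite List.map-++ ∣_∣ (map (bump ∣ p ∣) v) (p ∷ []) | map-∣bump∣ ∣ p ∣ v =
  unique-∷ʳ⁺ (Unique.map⁺ (bumpℕ-injective ∣ p ∣) uv) skipped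
  where
  skipped : ∣ p ∣ ∉ map (bumpℕ ∣ p ∣) (map ∣_∣ v)
  skipped j∈ with k , _ , j≡ ← ∈-map⁻ (bumpℕ ∣ p ∣) j∈ = bumpℕ-≢ ∣ p ∣ k (sym j≡)

unique-extend⁻ : ∀ p {v} → Unique (map ∣_∣ (extend p v)) → Unique (map ∣_∣ v)
unique-extend⁻ p {v} u rewrite List.map-++ ∣_∣ (map (bump ∣ p ∣) v) (p ∷ []) | map-∣bump∣ ∣ p ∣ v =
  Unique.map⁻ (proj₁ (unique-∷ʳ⁻ _ u))

counted-extend⁺ : ∀ {k p q v} → InRange (suc (suc k)) p → Counted (suc k) q v →
                 Step (flips k true) (bump ∣ p ∣ q) p → Counted (suc (suc k)) p (extend p v)
counted-extend⁺         {v = []}    _       (_ , _ , ())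
counted-extend⁺ {p = p} {v = y ∷ r} p-range ((refl , inRange , unique) , alt , last) step =
  (length-extend p (y ∷ r) , All.∷ʳ⁺ (All.map⁺ (All.map (λ {x} → inRange-bump ∣ p ∣ {x}) inRange)) p-range ,
   unique-extend⁺ p {y ∷ r} unique) ,
  alt-∷ʳ⁺ true (bump ∣ p ∣ y) (map (bump ∣ p ∣) r)
    (alt-map⁺ (bump-mono-< ∣ p ∣) true (y ∷ r) alt) (lastIs-map (bump ∣ p ∣) (y ∷ r) last)
    (subst (λ l → Step (flips l true) _ p) (sym (List.length-map (bump ∣ p ∣) r)) step) ,
  lastIs-∷ʳ (map (bump ∣ p ∣) (y ∷ r)) p

counted-extend⁻ : ∀ {k p} v → InRange (suc (suc k)) p → Counted (suc (suc k)) p (extend p v) →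
                  ∃ λ q → Counted (suc k) q v × Step (flips k true) (bump ∣ p ∣ q) p
counted-extend⁻         []      _ ((() , _) , _)
counted-extend⁻ {k} {p} (y ∷ r) (1≤∣p∣ , ∣p∣≤2+k) ((len , inRange , unique) , alt , _)
  with q , last ← lastIs-exists y r
  with alt′ , step ← alt-∷ʳ⁻ true (bump ∣ p ∣ y) (map (bump ∣ p ∣) r) alt
                             (lastIs-map (bump ∣ p ∣) (y ∷ r) last)
  = q ,
    ((length-v , inRange-v , unique-extend⁻ p {y ∷ r} unique) ,
     alt-map⁻ (bump-cancel-< ∣ p ∣) true (y ∷ r) alt′ , last) ,
    subst (λ l → Step (flips l true) _ p)
          (trans (List.length-map (bump ∣ p ∣) r) (ℕ.suc-injective length-v)) step
  where
  length-v : length (y ∷ r) ≡ suc k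
  length-v = ℕ.suc-injective (trans (sym (length-extend p (y ∷ r))) len)
  inRange-v : All (InRange (suc k)) (y ∷ r)
  inRange-v = All.map (λ {x} → inRange-bump⁻ {x = x} 1≤∣p∣ ∣p∣≤2+k) (All.map⁻ (proj₁ (All.∷ʳ⁻ inRange)))

counted⇒extend : ∀ {n p} w → InRange n p → Counted n p w → ∃ λ v → w ≡ extend p v
counted⇒extend {p = p} w (1≤∣p∣ , _) ((_ , _ , unique) , _ , last)
  with u , refl ← lastIs⇒∷ʳ w last
  with v , refl ← map-preimage (bump ∣ p ∣)
                    (All.map (λ {x} → bump-surjective x 1≤∣p∣) (unique-map-∷ʳ⁻ ∣_∣ u unique))
  = v , refl

bump<-[1+]⇔ : ∀ i q → bump (suc i) q < -[1+ i ] ⇔ q ℤ.≤ -[1+ i ]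
bump<-[1+]⇔ i q = mk⇔ (to q) (from q)
  where
  to : ∀ q → bump (suc i) q < -[1+ i ] → q ℤ.≤ -[1+ i ]
  to (+ k) b<p with suc i ℕ.≤? k
  to (+ k) () | yes _
  to (+ k) () | no  _
  to -[1+ k ] b<p with suc i ℕ.≤? suc k
  to -[1+ k ] _ | yes (s≤s i≤k) = -≤- i≤k
  to -[1+ k ] (-<- i<k) | no 1+i≰1+k = contradiction (s≤s (ℕ.<⇒≤ i<k)) 1+i≰1+k
  from : ∀ q → q ℤ.≤ -[1+ i ] → bump (suc i) q < -[1+ i ]
  from -[1+ k ] (-≤- i≤k) with suc i ℕ.≤? suc k
  ... | yes _       = -<- (s≤s i≤k)
  ... | no  1+i≰1+k = contradiction (s≤s i≤k) 1+i≰1+k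

bump<+[1+]⇔ : ∀ i q → bump (suc i) q < + suc i ⇔ q < + suc i
bump<+[1+]⇔ i q = mk⇔ (to q) (from q)
  where
  to : ∀ q → bump (suc i) q < + suc i → q < + suc i
  to (+ k) b<p with suc i ℕ.≤? k
  to (+ k) (+<+ 1+k<1+i) | yes 1+i≤k = contradiction (ℕ.<-trans 1+k<1+i (s≤s 1+i≤k)) (ℕ.<-irrefl refl)
  to (+ k) b<p | no _ = b<p
  to -[1+ k ] _ = -<+
  from : ∀ q → q < + suc i → bump (suc i) q < + suc i
  from (+ k) (+<+ k<1+i) with suc i ℕ.≤? k
  ... | yes 1+i≤k = contradiction 1+i≤k (ℕ.<⇒≱ k<1+i)
  ... | no  _     = +<+ k<1+i
  from -[1+ k ] _ with suc i ℕ.≤? suc k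
  ... | yes _ = -<+
  ... | no  _ = -<+

+[1+]<bump⇔ : ∀ i q → + suc i < bump (suc i) q ⇔ + suc i ℤ.≤ q
+[1+]<bump⇔ i q = mk⇔ (to q) (from q)
  where
  to : ∀ q → + suc i < bump (suc i) q → + suc i ℤ.≤ q
  to (+ k) p<b with suc i ℕ.≤? k
  to (+ k) _ | yes 1+i≤k = +≤+ 1+i≤k
  to (+ k) (+<+ 1+i<k) | no 1+i≰k = contradiction (ℕ.<⇒≤ 1+i<k) 1+i≰k
  to -[1+ k ] p<b with suc i ℕ.≤? suc k
  to -[1+ k ] () | yes _
  to -[1+ k ] () | no  _
  from : ∀ q → + suc i ℤ.≤ q → + suc i < bump (suc i) q
  from (+ k) (+≤+ 1+i≤k) with suc i ℕ.≤? k
  ... | yes _     = +<+ (s≤s 1+i≤k)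
  ... | no  1+i≰k = contradiction 1+i≤k 1+i≰k

-[1+]<bump⇔ : ∀ i q → -[1+ i ] < bump (suc i) q ⇔ -[1+ i ] < q
-[1+]<bump⇔ i q = mk⇔ (to q) (from q)
  where
  to : ∀ q → -[1+ i ] < bump (suc i) q → -[1+ i ] < q
  to (+ k) _ = -<+
  to -[1+ k ] p<b with suc i ℕ.≤? suc k
  to -[1+ k ] (-<- 1+k<i) | yes 1+i≤1+k =
    contradiction (ℕ.<-≤-trans (ℕ.m<n⇒m<1+n 1+k<i) 1+i≤1+k) (ℕ.<-irrefl refl)
  to -[1+ k ] p<b | no _ = p<b
  from : ∀ q → -[1+ i ] < q → -[1+ i ] < bump (suc i) q
  from (+ k) _ with suc i ℕ.≤? k
  ... | yes _ = -<+
  ... | no  _ = -<+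
  from -[1+ k ] (-<- k<i) with suc i ℕ.≤? suc k
  ... | yes 1+i≤1+k = contradiction 1+i≤1+k (ℕ.<⇒≱ (s≤s k<i))
  ... | no  _       = -<- k<i

a-recurrence : ∀ {k d p} {C : ℤ → Set} → flips k true ≡ d → p ∈ letters (suc (suc k)) →
             (C? : Decidable C) → (∀ q → Step d (bump ∣ p ∣ q) p ⇔ C q) →
             a (suc (suc k)) p ≡ sumOver C? (a (suc k)) (suc k)
a-recurrence {k} {p = p} refl p∈ C? step⇔C = begin
  length (filter (counted? n p) (words n)) ≡⟨ unique∧set⇒length≡ longer-unique shorter-unique (mk⇔ to from) ⟩
  length (map (extend p) shorter)         ≡⟨ List.length-map (extend p) shorter ⟩
  length shorter                          ≡⟨ length-fibres (counted? m) Qs (words m) ⟩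
  sumOver C? (a m) m                      ∎
  where
  open ≡-Reasoning
  m n : ℕ
  m = suc k
  n = suc m
  words : ℕ → List (List ℤ)
  words l = wordsOver (letters l) l
  Qs : List ℤ
  Qs = filter C? (letters m)
  shorter : List (List ℤ)
  shorter = fibres (counted? m) Qs (words m)
  p-range : InRange n p
  p-range = ∈-letters⁻ p∈
  longer-unique : Unique (filter (counted? n p) (words n))
  longer-unique = Unique.filter⁺ (counted? n p) (wordsOver-unique n (letters-unique n))
  shorter-unique : Unique (map (extend p) shorter)
  shorter-unique = Unique.map⁺ (extend-injective p)
    (fibres-unique (counted? m) counted-functional
                   (Unique.filter⁺ C? (letters-unique m)) (wordsOver-unique m (letters-unique m)))
  to : ∀ {w} → w ∈ filter (counted? n p) (words n) → w ∈ map (extend p) shorter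
  to {w} w∈
    with counted-w ← proj₂ (∈-filter⁻ (counted? n p) {xs = words n} w∈)
    with v , refl ← counted⇒extend w p-range counted-w
    with q , counted , step ← counted-extend⁻ v p-range counted-w
    = ∈-map⁺ (extend p)
      (∈-fibres⁺ (counted? m) (∈-filter⁺ C? (counted⇒last∈letters counted) (Equivalence.to (step⇔C q) step))
                 (counted⇒∈wordsOver counted) counted)
  from : ∀ {w} → w ∈ map (extend p) shorter → w ∈ filter (counted? n p) (words n)
  from w∈
    with v , v∈ , refl ← ∈-map⁻ (extend p) w∈
    with q , q∈Qs , counted ← ∈-fibres⁻ (counted? m) Qs {words m} v∈
    with C-q ← proj₂ (∈-filter⁻ C? {xs = letters m} q∈Qs)
    with counted-w ← counted-extend⁺ p-range counted (Equivalence.from (step⇔C q) C-q)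
    = ∈-filter⁺ (counted? n p) (counted⇒∈wordsOver counted-w) counted-w

proposition7p1 :
    (a 1 (+ 1) ≡ 1 × a 1 (- (+ 1)) ≡ 1)
    × (∀ (n : ℕ) (p : ℤ) → 2 ≤ n → p ∈ letters n →
         (n % 2 ≡ 0 → p <ℤ + 0 → a n p ≡ sumOver (λ q → q ≤? p) (a (n ∸ 1)) (n ∸ 1))
         × (n % 2 ≡ 0 → + 0 <ℤ p → a n p ≡ sumOver (λ q → q <? p) (a (n ∸ 1)) (n ∸ 1))
         × (n % 2 ≡ 1 → + 0 <ℤ p → a n p ≡ sumOver (λ q → p ≤? q) (a (n ∸ 1)) (n ∸ 1))
         × (n % 2 ≡ 1 → p <ℤ + 0 → a n p ≡ sumOver (λ q → p <? q) (a (n ∸ 1)) (n ∸ 1)))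
proposition7p1 = (refl , refl) , λ where
  (suc (suc k)) (+ zero) (s≤s (s≤s z≤n)) _ →
    (λ _ → λ { (+<+ ()) }) , (λ _ → λ { (+<+ ()) }) , (λ _ → λ { (+<+ ()) }) , (λ _ → λ { (+<+ ()) })
  (suc (suc k)) (+ suc i) (s≤s (s≤s z≤n)) p∈ →
    (λ _ → λ { (+<+ ()) }) ,
    (λ even _ → a-recurrence (flips-even k even) p∈ (λ q → q <? + suc i) (bump<+[1+]⇔ i)) ,
    (λ odd _ → a-recurrence (flips-odd k odd) p∈ (λ q → + suc i ≤? q) (+[1+]<bump⇔ i)) ,
    (λ _ → λ { (+<+ ()) })
  (suc (suc k)) -[1+ i ] (s≤s (s≤s z≤n)) p∈ →
    (λ even _ → a-recurrence (flips-even k even) p∈ (λ q → q ≤? -[1+ i ]) (bump<-[1+]⇔ i)) ,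
    (λ _ → λ ()) ,
    (λ _ → λ ()) ,
    (λ odd _ → a-recurrence (flips-odd k odd) p∈ (λ q → -[1+ i ] <? q) (-[1+]<bump⇔ i))
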